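{- There is no distinct covering system whose least modulus is $4$ and whose moduli have least common multiple $180$.
   Context: A covering system (covering) is a finite set of congruences $\{x \equiv r_i \pmod{n_i}\}$ with positive integer moduli such that every integer satisfies at least one of them. A covering is distinct if its moduli are pairwise distinct and greater than $1$. -}

module Defs where

open import Data.Nat using (ℕ; _≤_)
open import Data.Nat.LCM using (lcm)
open import Data.Integer using (ℤ; +_; _-_)
open import Data.Integer.Divisibility using (_∣_)
open import Data.List using (List; map; foldr)
open import Data.List.Relation.Unary.All using (All)
open import Data.List.Relation.Unary.Any using (Any)
open import Data.List.Relation.Unary.Unique.Propositional using (Unique)
open import Data.List.Membership.Propositional using (_∈_)
open import Data.Product using (_×_; proj₁; proj₂)

Congruence : Set
Congruence = ℤ × ℕ

residue : Congruence → ℤ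
residue = proj₁

modulus : Congruence → ℕ
modulus = proj₂

Satisfies : ℤ → Congruence → Set
Satisfies x c = (+ modulus c) ∣ (x - residue c)

moduli : List Congruence → List ℕ
moduli = map modulus

IsCovering : List Congruence → Set
IsCovering cs = All (λ n → 1 ≤ n) (moduli cs) × ((x : ℤ) → Any (Satisfies x) cs)

IsDistinctCovering : List Congruence → Set
IsDistinctCovering cs =
  IsCovering cs × Unique (moduli cs) × All (λ n → 2 ≤ n) (moduli cs)

LeastModulus : List Congruence → ℕ → Set
LeastModulus cs m = m ∈ moduli cs × All (λ n → m ≤ n) (moduli cs)

lcmModuli : List Congruence → ℕ
lcmModuli cs = foldr lcm 1 (moduli cs)

module Submission where

-- Suppose a distinct covering has least modulus 4 and lcm of moduli 180.  Its
-- moduli are then pairwise distinct divisors of 180 that are at least 4, and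
-- restricted to the natural numbers 0, 1, ..., 179 it picks, for each such
-- divisor n, at most one residue class modulo n, and these classes cover all
-- 180 points.  The reciprocals of the candidate moduli sum to 216/180 > 1, so
-- counting alone does not exclude this; a finite search does.

open import Defs
open import Data.List using (List)
open import Data.Product using (_×_)
open import Relation.Binary.PropositionalEquality using (_≡_)
open import Relation.Nullary using (¬_)

open import Data.Bool using (Bool; true; false; _∧_; _∨_; T)
open import Data.Bool.ListAction using (any)
open import Data.Bool.Properties using (T-≡; T-∧; T-∨)
open import Data.Integer using (+_; _-_; _⊖_; ∣_∣; _%ℕ_; _/ℕ_)
  renaming (_+_ to _+ℤ_; _*_ to _*ℤ_)
open import Data.Integer.DivMod using (n%ℕd<d; a≡a%ℕn+[a/ℕn]*n)
open import Data.Integer.Properties using (m-n≡m⊖n; ⊖-≥; ∣⊖∣-<)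
open import Data.Integer.Tactic.RingSolver using (solve-∀)
import Data.Integer.Divisibility.Signed as Signed
open import Data.List using ([]; _∷_; filter; length; map; upTo; null; foldr)
open import Data.List.Extrema.Nat using (max; xs≤max; max≤v⁺)
open import Data.List.Membership.Propositional using (_∈_; find; lose)
open import Data.List.Membership.Propositional.Properties
  using (∈-upTo⁺; ∈-map⁺; ∈-filter⁺)
open import Data.List.Relation.Binary.Sublist.Propositional using (_⊆_)
open import Data.List.Relation.Binary.Sublist.Propositional.Properties
  using (filter-⊆; filter⁺; length-mono-≤)
open import Data.List.Relation.Unary.All as All using (All; []; _∷_)
open import Data.List.Relation.Unary.All.Properties
  using (all-filter; map⁺) renaming (filter⁺ to All-filter⁺)
open import Data.List.Relation.Unary.AllPairs using (_∷_)
open import Data.List.Relation.Unary.Any using (Any; here; there)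
open import Data.List.Relation.Unary.Any.Properties using (any⁺)
open import Data.List.Relation.Unary.Unique.Propositional using (Unique)
open import Data.Maybe using (Maybe; just; nothing)
open import Data.Maybe.Properties using (just-injective)
open import Data.Nat using (ℕ; zero; suc; _+_; _∸_; _≤_; _<_; _≤ᵇ_; z≤n; s≤s; >-nonZero)
open import Data.Nat.DivMod using (_%_; %-congˡ; %-remove-+ʳ; m<n⇒m%n≡m)
open import Data.Nat.Divisibility using (_∣_; _∣?_; ∣⇒≤; ∣-trans)
open import Data.Nat.LCM using (lcm; m∣lcm[m,n]; n∣lcm[m,n])
open import Data.Nat.ListAction using (sum)
open import Data.Nat.Properties
  using (_≟_; _≤?_; ≤-trans; m≤n+m; m∸n≤m; +-suc; +-mono-≤; +-monoʳ-≤;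
         m+[n∸m]≡n; ≤⇒≤ᵇ; ≰⇒>; m<n⇒0<n∸m; <⇒≱; module ≤-Reasoning)
open import Data.Product using (_,_)
open import Data.Sum using (_⊎_; inj₁; inj₂)
open import Function.Bundles using (Equivalence)
open import Relation.Binary.PropositionalEquality
  using (refl; sym; trans; cong; subst; module ≡-Reasoning)
open import Relation.Nullary using (yes; no; does; contradiction)
open import Relation.Nullary.Decidable using (_×-dec_)
open import Relation.Unary using (Pred; Decidable)
open import Relation.Unary.Properties using (∁?)

length-filter-split : ∀ {a p} {A : Set a} {P : Pred A p} (P? : Decidable P) xs →
  length xs ≡ length (filter P? xs) + length (filter (∁? P?) xs)
length-filter-split P? []       = refl
length-filter-split P? (x ∷ xs) with does (P? x)
... | true  = cong suc (length-filter-split P? xs)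
... | false = trans (cong suc (length-filter-split P? xs)) (sym (+-suc _ _))

rem : ℕ → ℕ → ℕ
rem x zero    = x
rem x (suc m) = x % suc m

InClass : ℕ → ℕ → Pred ℕ _
InClass n ρ x = rem x n ≡ ρ

inClass? : ∀ n ρ → Decidable (InClass n ρ)
inClass? n ρ x = rem x n ≟ ρ

inside : ℕ → ℕ → List ℕ → List ℕ
inside n ρ = filter (inClass? n ρ)

outside : ℕ → ℕ → List ℕ → List ℕ
outside n ρ = filter (∁? (inClass? n ρ))

largestClass : ℕ → List ℕ → ℕ
largestClass n xs = max 0 (map (λ ρ → length (inside n ρ xs)) (upTo n))

capacity : List ℕ → List ℕ → ℕ
capacity ns xs = sum (map (λ n → largestClass n xs) ns)

class≤largestClass : ∀ {n ρ} xs → ρ ∈ upTo n → length (inside n ρ xs) ≤ largestClass n xs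
class≤largestClass xs ρ∈ = All.lookup (xs≤max 0 _) (∈-map⁺ _ ρ∈)

largestClass-mono : ∀ n {ys xs} → ys ⊆ xs → largestClass n ys ≤ largestClass n xs
largestClass-mono n {ys} {xs} ys⊆xs = max≤v⁺ z≤n (map⁺ (All.tabulate class-mono))
  where
  class-mono : ∀ {ρ} → ρ ∈ upTo n → length (inside n ρ ys) ≤ largestClass n xs
  class-mono {ρ} ρ∈ = ≤-trans
    (length-mono-≤ (filter⁺ (inClass? n ρ) (inClass? n ρ) (λ { refl p → p }) ys⊆xs))
    (class≤largestClass xs ρ∈)

capacity-mono : ∀ ns {ys xs} → ys ⊆ xs → capacity ns ys ≤ capacity ns xs
capacity-mono []       _     = z≤n
capacity-mono (n ∷ ns) ys⊆xs = +-mono-≤ (largestClass-mono n ys⊆xs) (capacity-mono ns ys⊆xs)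

-- An assignment chooses at most one residue class for every modulus.
Assignment : Set
Assignment = ℕ → Maybe ℕ

Valid : Assignment → Set
Valid a = ∀ {n ρ} → a n ≡ just ρ → ρ < n

Covered : Assignment → List ℕ → ℕ → Set
Covered a ns x = Any (λ n → a n ≡ just (rem x n)) ns

module _ {a : Assignment} where

  drop-modulus : ∀ {n ns x} → ¬ a n ≡ just (rem x n) → Covered a (n ∷ ns) x → Covered a ns x
  drop-modulus miss (here hit) = contradiction hit miss
  drop-modulus miss (there c)  = c

  unused-modulus : ∀ {n ns xs} → a n ≡ nothing →
    All (Covered a (n ∷ ns)) xs → All (Covered a ns) xs
  unused-modulus {n} a[n]≡nothing = All.map (drop-modulus miss)
    where
    miss : ∀ {x} → ¬ a n ≡ just x
    miss hit with trans (sym a[n]≡nothing) hit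
    ... | ()

  remove-chosen-class : ∀ {n ns ρ} xs → a n ≡ just ρ →
    All (Covered a (n ∷ ns)) xs → All (Covered a ns) (outside n ρ xs)
  remove-chosen-class {n} {ρ = ρ} xs a[n]≡ρ covered = All.zipWith
    (λ (off , c) → drop-modulus (λ hit → off (sym (just-injective (trans (sym a[n]≡ρ) hit)))) c)
    (all-filter (∁? (inClass? n ρ)) xs , All-filter⁺ (∁? (inClass? n ρ)) covered)

  capacity-bound : Valid a → ∀ ns xs → All (Covered a ns) xs → length xs ≤ capacity ns xs
  capacity-bound valid []       []      _           = z≤n
  capacity-bound valid []       (_ ∷ _) (() ∷ _)
  capacity-bound valid (n ∷ ns) xs      covered with a n in a[n]
  ... | nothing = ≤-trans (capacity-bound valid ns xs (unused-modulus a[n] covered))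
                          (m≤n+m _ (largestClass n xs))
  ... | just ρ  = begin
    length xs
      ≡⟨ length-filter-split (inClass? n ρ) xs ⟩
    length (inside n ρ xs) + length (outside n ρ xs)
      ≤⟨ +-mono-≤ (class≤largestClass xs (∈-upTo⁺ (valid a[n])))
                  (capacity-bound valid ns _ (remove-chosen-class xs a[n] covered)) ⟩
    largestClass n xs + capacity ns (outside n ρ xs)
      ≤⟨ +-monoʳ-≤ (largestClass n xs) (capacity-mono ns (filter-⊆ _ xs)) ⟩
    capacity (n ∷ ns) xs ∎
    where open ≤-Reasoning

-- Decides whether the points xs can be covered by choosing at most one class
-- for each modulus of ns: the modulus n is either left unused or one of its
-- classes is removed from xs; a branch is cut once xs exceeds its capacity.
search : List ℕ → List ℕ → Bool
search []       xs = null xs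
search (n ∷ ns) xs =
  (length xs ≤ᵇ capacity (n ∷ ns) xs) ∧
  (search ns xs ∨ any (λ ρ → search ns (outside n ρ xs)) (upTo n))

search-complete : ∀ {a} → Valid a → ∀ ns xs → All (Covered a ns) xs → search ns xs ≡ true
search-complete valid []       []      _        = refl
search-complete valid []       (_ ∷ _) (() ∷ _)
search-complete {a} valid (n ∷ ns) xs covered =
  Equivalence.to T-≡ (Equivalence.from T-∧ (fits , Equivalence.from T-∨ branch))
  where
  fits : T (length xs ≤ᵇ capacity (n ∷ ns) xs)
  fits = ≤⇒≤ᵇ (capacity-bound valid (n ∷ ns) xs covered)
  branch : T (search ns xs) ⊎ T (any (λ ρ → search ns (outside n ρ xs)) (upTo n))
  branch with a n in a[n]
  ... | nothing = inj₁ (Equivalence.from T-≡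
                    (search-complete valid ns xs (unused-modulus a[n] covered)))
  ... | just ρ  = inj₂ (any⁺ _ (lose (∈-upTo⁺ (valid a[n])) (Equivalence.from T-≡
                    (search-complete valid ns _ (remove-chosen-class xs a[n] covered)))))

remainder-unique : ∀ {n k ρ} → ρ < suc n → suc n ∣ ∣ k ⊖ ρ ∣ → k % suc n ≡ ρ
remainder-unique {n} {k} {ρ} ρ<d d∣ with ρ ≤? k
... | yes ρ≤k = begin
  k % suc n               ≡⟨ %-congˡ (sym (m+[n∸m]≡n ρ≤k)) ⟩
  (ρ + (k ∸ ρ)) % suc n   ≡⟨ %-remove-+ʳ ρ (subst (suc n ∣_) (cong ∣_∣ (⊖-≥ ρ≤k)) d∣) ⟩
  ρ % suc n               ≡⟨ m<n⇒m%n≡m ρ<d ⟩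
  ρ                       ∎
  where open ≡-Reasoning
... | no ρ≰k = contradiction (≤-trans d≤ρ∸k (m∸n≤m ρ k)) (<⇒≱ ρ<d)
  where
  k<ρ : k < ρ
  k<ρ = ≰⇒> ρ≰k
  d≤ρ∸k : suc n ≤ ρ ∸ k
  d≤ρ∸k = ∣⇒≤ {{>-nonZero (m<n⇒0<n∸m k<ρ)}} (subst (suc n ∣_) (∣⊖∣-< k<ρ) d∣)

canonicalResidue : Congruence → ℕ
canonicalResidue (r , zero)  = 0
canonicalResidue (r , suc m) = r %ℕ suc m

canonicalResidue<modulus : ∀ c → 1 ≤ modulus c → canonicalResidue c < modulus c
canonicalResidue<modulus (r , suc m) _ = n%ℕd<d r (suc m)

-- A natural number satisfying a congruence with positive modulus lies in its
-- canonical class: k - ρ = (k - r) + q n, where r = ρ + q n.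
satisfies⇒inClass : ∀ c k → 1 ≤ modulus c → Satisfies (+ k) c →
  rem k (modulus c) ≡ canonicalResidue c
satisfies⇒inClass (r , suc m) k _ sat =
  remainder-unique (n%ℕd<d r d) (subst (λ z → d ∣ ∣ z ∣) k-r+qd≡k⊖ρ (Signed.∣⇒∣ᵤ d∣k-r+qd))
  where
  d = suc m
  ρ = r %ℕ d
  q = r /ℕ d
  d∣k-r+qd : + d Signed.∣ (+ k - r) +ℤ q *ℤ + d
  d∣k-r+qd = Signed.∣m∣n⇒∣m+n (Signed.∣ᵤ⇒∣ {i = + k - r} sat) (Signed.∣n⇒∣m*n q Signed.∣-refl)
  cancel : ∀ x y z → x - (y +ℤ z) +ℤ z ≡ x - y
  cancel = solve-∀
  k-r+qd≡k⊖ρ : (+ k - r) +ℤ q *ℤ + d ≡ k ⊖ ρ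
  k-r+qd≡k⊖ρ = begin
    (+ k - r) +ℤ q *ℤ + d
      ≡⟨ cong (λ z → (+ k - z) +ℤ q *ℤ + d) (a≡a%ℕn+[a/ℕn]*n r d) ⟩
    (+ k - (+ ρ +ℤ q *ℤ + d)) +ℤ q *ℤ + d
      ≡⟨ cancel (+ k) (+ ρ) (q *ℤ + d) ⟩
    + k - + ρ
      ≡⟨ m-n≡m⊖n k ρ ⟩
    k ⊖ ρ ∎
    where open ≡-Reasoning

assignmentOf : List Congruence → Assignment
assignmentOf []             n = nothing
assignmentOf ((r , m) ∷ cs) n with m ≟ n
... | yes _ = just (canonicalResidue (r , m))
... | no  _ = assignmentOf cs n

assignmentOf-valid : ∀ cs → All (1 ≤_) (moduli cs) → Valid (assignmentOf cs)
assignmentOf-valid ((r , m) ∷ cs) (1≤m ∷ positive) {n} hit with m ≟ n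
... | yes refl = subst (_< m) (just-injective hit) (canonicalResidue<modulus (r , m) 1≤m)
... | no  _    = assignmentOf-valid cs positive hit

assignmentOf-distinct : ∀ {cs c} → Unique (moduli cs) → c ∈ cs →
  assignmentOf cs (modulus c) ≡ just (canonicalResidue c)
assignmentOf-distinct {(r , m) ∷ cs} _ (here refl) with m ≟ m
... | yes _   = refl
... | no  m≢m = contradiction refl m≢m
assignmentOf-distinct {(r , m) ∷ cs} {c} (m∉ ∷ distinct) (there c∈cs) with m ≟ modulus c
... | yes m≡ = contradiction m≡ (All.lookup m∉ (∈-map⁺ modulus c∈cs))
... | no  _  = assignmentOf-distinct distinct c∈cs

covering⇒covered : ∀ {cs ns} → IsCovering cs → Unique (moduli cs) →
  All (_∈ ns) (moduli cs) → ∀ k → Covered (assignmentOf cs) ns k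
covering⇒covered (positive , covers) distinct inNs k with find (covers (+ k))
... | c , c∈cs , sat = lose (All.lookup inNs modulus∈)
  (trans (assignmentOf-distinct distinct c∈cs)
         (cong just (sym (satisfies⇒inClass c k (All.lookup positive modulus∈) sat))))
  where modulus∈ = ∈-map⁺ modulus c∈cs

∣lcm : ∀ {m ms} → m ∈ ms → m ∣ foldr lcm 1 ms
∣lcm {ms = x ∷ ms} (here refl) = m∣lcm[m,n] x _
∣lcm {ms = x ∷ ms} (there m∈) = ∣-trans (∣lcm m∈) (n∣lcm[m,n] x _)

IsCandidate : ℕ → Set
IsCandidate m = 4 ≤ m × m ∣ 180

isCandidate? : Decidable IsCandidate
isCandidate? m = (4 ≤? m) ×-dec (m ∣? 180)

-- The candidates in increasing order; a divisor of 180 is at most 180.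
candidateModuli : List ℕ
candidateModuli = filter isCandidate? (upTo 181)

candidate : ∀ {m} → IsCandidate m → m ∈ candidateModuli
candidate c@(_ , m∣180) = ∈-filter⁺ isCandidate? (∈-upTo⁺ (s≤s (∣⇒≤ m∣180))) c

search-fails : search candidateModuli (upTo 180) ≡ false
search-fails = refl

lemma6 : (cs : List Congruence) →
    ¬ (IsDistinctCovering cs × LeastModulus cs 4 × lcmModuli cs ≡ 180)
lemma6 cs ((covering@(positive , _) , distinct , _) , (_ , atLeast4) , lcm≡180) =
  contradiction (trans (sym search-succeeds) search-fails) λ ()
  where
  moduli-candidates : All (_∈ candidateModuli) (moduli cs)
  moduli-candidates = All.tabulate λ {m} m∈ →
    candidate (All.lookup atLeast4 m∈ , subst (m ∣_) lcm≡180 (∣lcm m∈))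
  search-succeeds : search candidateModuli (upTo 180) ≡ true
  search-succeeds = search-complete (assignmentOf-valid cs positive) candidateModuli (upTo 180)
    (All.tabulate (λ {k} _ → covering⇒covered covering distinct moduli-candidates k))
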